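{- Let $G_v$ be a rooted graph with $I(G_v;-1)=[a-b,a,b]$. Then $I(G_v^1;-1)=[-b,a-b,a]$, $I(G_v^2;-1)=[-a,-b,a-b]$, and $I(G_v^3;-1)=[b-a,-a,-b]$; in particular $I(G_v^3;-1)=-I(G_v;-1)$.
   Context: All graphs are finite and simple. The independence polynomial of $G$ is $I(G;x)=\sum_{j\ge 0} s_j x^j$, where $s_j$ is the number of independent sets of size $j$ in $G$ (with $s_0=1$). A rooted graph $G_v$ is a graph $G$ with a distinguished vertex $v$ (the root); $I(G_v;-1)$ means $I(G;-1)$. For a vertex $v$, $N[v]$ denotes $v$ together with its neighbours. Bracket notation: writing $I(G_v;-1)=[x,a,b]$ means $I(G-v;-1)=a$, $I(G-N[v];-1)=b$, and $x=a-b=I(G;-1)$. For an integer $\ell\ge 0$, the $\ell$-extension $G_v^\ell$ is the rooted graph obtained by identifying the root $v$ with one endpoint of a vertex-disjoint path with $\ell$ edges and making the other endpoint of the path the new root (so $G_v^0=G_v$). -}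

module Defs where

open import Data.Bool using (Bool; true; false; _∧_; _∨_; not; T)
open import Data.Nat using (ℕ; zero; suc; _≡ᵇ_)
open import Data.Fin using (Fin; zero; suc; fromℕ; inject₁; _≟_)
open import Data.Vec using (Vec; []; _∷_; lookup; replicate)
open import Data.List using (List; []; _∷_; _++_; map; allFin; upTo)
import Data.Integer as ℤ
open ℤ using (ℤ; +_; -_)
open import Data.Product using (_×_; _,_)
open import Relation.Binary.PropositionalEquality using (_≡_; refl)
open import Relation.Nullary.Decidable using (⌊_⌋)

record Graph (n : ℕ) : Set where
  field
    adj   : Fin n → Fin n → Bool
    sym   : ∀ i j → adj i j ≡ adj j i
    irrefl : ∀ i → adj i i ≡ false
open Graph public

record Rooted : Set where
  constructor rooted
  field
    size  : ℕ
    graph : Graph size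
    root  : Fin size
open Rooted public

allᵇ : {A : Set} → (A → Bool) → List A → Bool
allᵇ p []       = true
allᵇ p (x ∷ xs) = p x ∧ allᵇ p xs

countᵇ : {A : Set} → (A → Bool) → List A → ℕ
countᵇ p []       = 0
countᵇ p (x ∷ xs) with p x
... | true  = suc (countᵇ p xs)
... | false = countᵇ p xs

Subset : ℕ → Set
Subset n = Vec Bool n

allSubsets : (n : ℕ) → List (Subset n)
allSubsets zero    = [] ∷ []
allSubsets (suc n) = map (false ∷_) (allSubsets n) ++ map (true ∷_) (allSubsets n)

_∈ˢ_ : ∀ {n} → Fin n → Subset n → Bool
i ∈ˢ S = lookup S i

_⊆ᵇ_ : ∀ {n} → Subset n → Subset n → Bool
_⊆ᵇ_ {n} S U = allᵇ (λ i → not (i ∈ˢ S) ∨ (i ∈ˢ U)) (allFin n)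

card : ∀ {n} → Subset n → ℕ
card []          = 0
card (true ∷ S)  = suc (card S)
card (false ∷ S) = card S

independent : ∀ {n} → Graph n → Subset n → Bool
independent {n} G S =
  allᵇ (λ i → allᵇ (λ j → not (i ∈ˢ S ∧ j ∈ˢ S ∧ adj G i j)) (allFin n)) (allFin n)

-- s_j of the induced subgraph G[U]: number of independent sets of G[U]
-- of size j (independent sets of G[U] = independent sets of G contained in U).
indepCount : ∀ {n} → Graph n → Subset n → ℕ → ℕ
indepCount {n} G U j =
  countᵇ (λ S → (S ⊆ᵇ U) ∧ independent G S ∧ (card S ≡ᵇ j)) (allSubsets n)

sign : ℕ → ℤ
sign zero    = + 1
sign (suc j) = - sign j

-- I(G[U]; -1) = Σ_{j=0}^{n} s_j (-1)^j   (s_j = 0 for j > n)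
sumℤ : List ℤ → ℤ
sumℤ []       = + 0
sumℤ (x ∷ xs) = x ℤ.+ sumℤ xs

Iat-1 : ∀ {n} → Graph n → Subset n → ℤ
Iat-1 {n} G U = sumℤ (map (λ j → (+ indepCount G U j) ℤ.* sign j) (upTo (suc n)))

fullSet : (n : ℕ) → Subset n
fullSet n = replicate n true

minusV : ∀ {n} → Fin n → Subset n
minusV {n} v = Data.Vec.tabulate (λ i → not ⌊ i ≟ v ⌋)

minusNv : ∀ {n} → Graph n → Fin n → Subset n
minusNv {n} G v = Data.Vec.tabulate (λ i → not (⌊ i ≟ v ⌋ ∨ adj G v i))

IR : Rooted → ℤ
IR (rooted n G v) = Iat-1 G (fullSet n)

-- Bracket [x, a, b] = [I(G;-1), I(G-v;-1), I(G-N[v];-1)]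
bracket : Rooted → ℤ × ℤ × ℤ
bracket (rooted n G v) = Iat-1 G (fullSet n) , Iat-1 G (minusV v) , Iat-1 G (minusNv G v)

-- 1-extension: add a new vertex (index zero; old vertex i becomes suc i)
-- adjacent exactly to the old root; the new vertex becomes the root.
ext1Adj : ∀ {n} → Graph n → Fin n → Fin (suc n) → Fin (suc n) → Bool
ext1Adj G v zero    zero    = false
ext1Adj G v zero    (suc j) = ⌊ j ≟ v ⌋
ext1Adj G v (suc i) zero    = ⌊ i ≟ v ⌋
ext1Adj G v (suc i) (suc j) = adj G i j

ext1Sym : ∀ {n} (G : Graph n) (v : Fin n) i j → ext1Adj G v i j ≡ ext1Adj G v j i
ext1Sym G v zero    zero    = refl
ext1Sym G v zero    (suc j) = refl
ext1Sym G v (suc i) zero    = refl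
ext1Sym G v (suc i) (suc j) = sym G i j

ext1Irr : ∀ {n} (G : Graph n) (v : Fin n) i → ext1Adj G v i i ≡ false
ext1Irr G v zero    = refl
ext1Irr G v (suc i) = irrefl G i

ext1 : Rooted → Rooted
ext1 (rooted n G v) = rooted (suc n) record { adj = ext1Adj G v ; sym = ext1Sym G v ; irrefl = ext1Irr G v } zero

-- ℓ-extension G_v^ℓ (attaching a path with ℓ edges = ℓ successive 1-extensions)
ext : ℕ → Rooted → Rooted
ext zero    R = R
ext (suc ℓ) R = ext1 (ext ℓ R)

-- Write I(G;-1) as the signed sum of (-1)^|S| over the independent sets S.
-- If u is a new leaf attached to v, the independent sets of G + uv split into
-- those avoiding u, which are the independent sets of G, and those of the form
-- S ∪ {u} with S independent in G - v; hence I(G + uv;-1) = I(G;-1) - I(G-v;-1).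
-- Moreover (G + uv) - u = G and (G + uv) - N[u] = G - v, so one extension maps
-- the bracket [x, a, b] to [x - a, x, a]; iterating three times gives the claim.
module Submission where

open import Defs hiding (sym)
open import Data.Integer using (ℤ; _-_; -_)
open import Data.Product using (_×_; _,_; proj₁)
open import Relation.Binary.PropositionalEquality using (_≡_)

open import Algebra.Bundles using (CommutativeMonoid)
import Algebra.Properties.CommutativeSemigroup as CommSemigroupProperties
open import Data.Bool using (Bool; true; false; _∧_; _∨_; not; if_then_else_)
open import Data.Bool.Properties
  using (∧-assoc; ∧-idem; ∧-identityʳ; ∧-zeroʳ; ∨-zeroʳ; ∧-commutativeMonoid)
open import Data.Fin using (Fin; zero; suc; _≟_)
open import Data.Integer using (+_; _+_; _*_)
open import Data.Integer.Properties
  using (+-identityˡ; +-identityʳ; +-assoc; +-commutativeSemigroup; neg-distrib-+; pos-+; *-identityˡ; *-distribʳ-+)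
open import Data.Integer.Tactic.RingSolver using (solve-∀)
open import Data.List using (List; []; _∷_; _++_; map; allFin; upTo)
import Data.List as List
open import Data.List.Properties using (map-∘; map-cong; map-upTo; map-applyUpTo)
open import Data.Nat using (ℕ; suc; _≤_; _<_; _≡ᵇ_; s≤s; z≤n)
open import Data.Nat.Properties using (m≤n⇒m≤1+n)
open import Data.Vec using ([]; _∷_; lookup; replicate)
open import Data.Vec.Properties using (lookup-replicate; lookup∘tabulate; tabulate∘lookup; tabulate-cong)
open import Function using (_∘_)
open import Relation.Binary.PropositionalEquality
  using (refl; sym; trans; cong; cong₂; module ≡-Reasoning)
open import Relation.Nullary.Decidable using (⌊_⌋; yes; no)

open CommSemigroupProperties +-commutativeSemigroup using () renaming (interchange to +-interchange)
open CommSemigroupProperties (CommutativeMonoid.commutativeSemigroup ∧-commutativeMonoid)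
  using () renaming (interchange to ∧-interchange)

private
  variable
    A B : Set
    n : ℕ

∑ : (A → ℤ) → List A → ℤ
∑ f xs = sumℤ (map f xs)

∑-cong : {f g : A → ℤ} (xs : List A) → (∀ x → f x ≡ g x) → ∑ f xs ≡ ∑ g xs
∑-cong xs f≗g = cong sumℤ (map-cong f≗g xs)

∑-map : (f : B → ℤ) (g : A → B) (xs : List A) → ∑ f (map g xs) ≡ ∑ (f ∘ g) xs
∑-map f g xs = cong sumℤ (sym (map-∘ xs))

∑-++ : (f : A → ℤ) (xs ys : List A) → ∑ f (xs ++ ys) ≡ ∑ f xs + ∑ f ys
∑-++ f []       ys = sym (+-identityˡ _)
∑-++ f (x ∷ xs) ys = trans (cong (_+_ (f x)) (∑-++ f xs ys)) (sym (+-assoc (f x) _ _))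

∑-zero : (xs : List A) → ∑ (λ _ → + 0) xs ≡ + 0
∑-zero []       = refl
∑-zero (x ∷ xs) = trans (+-identityˡ _) (∑-zero xs)

∑-neg : (f : A → ℤ) (xs : List A) → ∑ (λ x → - f x) xs ≡ - ∑ f xs
∑-neg f []       = refl
∑-neg f (x ∷ xs) = trans (cong (_+_ (- f x)) (∑-neg f xs)) (sym (neg-distrib-+ (f x) _))

∑-+ : (f g : A → ℤ) (xs : List A) → ∑ (λ x → f x + g x) xs ≡ ∑ f xs + ∑ g xs
∑-+ f g []       = refl
∑-+ f g (x ∷ xs) = trans (cong (_+_ (f x + g x)) (∑-+ f g xs)) (+-interchange (f x) (g x) _ _)

∑-*ʳ : (f : A → ℤ) (c : ℤ) (xs : List A) → ∑ f xs * c ≡ ∑ (λ x → f x * c) xs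
∑-*ʳ f c []       = refl
∑-*ʳ f c (x ∷ xs) = trans (*-distribʳ-+ c (f x) _) (cong (_+_ (f x * c)) (∑-*ʳ f c xs))

∑-swap : (g : A → B → ℤ) (xs : List A) (ys : List B) →
         ∑ (λ x → ∑ (g x) ys) xs ≡ ∑ (λ y → ∑ (λ x → g x y) xs) ys
∑-swap g []       ys = sym (∑-zero ys)
∑-swap g (x ∷ xs) ys =
  trans (cong (_+_ (∑ (g x) ys)) (∑-swap g xs ys)) (sym (∑-+ (g x) _ ys))

∑-upTo-suc : (f : ℕ → ℤ) (m : ℕ) → ∑ f (upTo (suc m)) ≡ f 0 + ∑ (f ∘ suc) (upTo m)
∑-upTo-suc f m = cong (λ ys → f 0 + sumℤ ys)
  (trans (map-applyUpTo suc f m) (sym (map-upTo (f ∘ suc) m)))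

when : Bool → ℤ → ℤ
when b x = if b then x else + 0

when-∧ : ∀ a b (x : ℤ) → when (a ∧ b) x ≡ when a (when b x)
when-∧ true  b x = refl
when-∧ false b x = refl

when-neg : ∀ b (x : ℤ) → when b (- x) ≡ - when b x
when-neg true  x = refl
when-neg false x = refl

when-1-* : ∀ b (x : ℤ) → when b (+ 1) * x ≡ when b x
when-1-* true  x = *-identityˡ x
when-1-* false x = refl

∑-when : ∀ b (f : A → ℤ) (xs : List A) → ∑ (λ x → when b (f x)) xs ≡ when b (∑ f xs)
∑-when true  f xs = refl
∑-when false f xs = ∑-zero xs

∑-upTo-when-≡ᵇ : (f : ℕ → ℤ) {c m : ℕ} → c < m →
                 ∑ (λ j → when (c ≡ᵇ j) (f j)) (upTo m) ≡ f c
∑-upTo-when-≡ᵇ f {0}     {suc m} _ =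
  trans (∑-upTo-suc (λ j → when (0 ≡ᵇ j) (f j)) m)
        (trans (cong (_+_ (f 0)) (∑-zero (upTo m))) (+-identityʳ (f 0)))
∑-upTo-when-≡ᵇ f {suc c} {suc m} (s≤s c<m) =
  trans (∑-upTo-suc (λ j → when (suc c ≡ᵇ j) (f j)) m)
        (trans (+-identityˡ _) (∑-upTo-when-≡ᵇ (f ∘ suc) c<m))

countᵇ-as-∑ : (p : A → Bool) (xs : List A) → + countᵇ p xs ≡ ∑ (λ x → when (p x) (+ 1)) xs
countᵇ-as-∑ p []       = refl
countᵇ-as-∑ p (x ∷ xs) with p x
... | true  = trans (pos-+ 1 (countᵇ p xs)) (cong (_+_ (+ 1)) (countᵇ-as-∑ p xs))
... | false = trans (countᵇ-as-∑ p xs) (sym (+-identityˡ _))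

card≤ : (S : Subset n) → card S ≤ n
card≤ []          = z≤n
card≤ (true ∷ S)  = s≤s (card≤ S)
card≤ (false ∷ S) = m≤n⇒m≤1+n (card≤ S)

signedIndependent : Graph n → Subset n → Subset n → ℤ
signedIndependent G U S = when (S ⊆ᵇ U) (when (independent G S) (sign (card S)))

Iat-1-as-∑ : (G : Graph n) (U : Subset n) →
             Iat-1 G U ≡ ∑ (signedIndependent G U) (allSubsets n)
Iat-1-as-∑ {n} G U = begin
    ∑ (λ j → + indepCount G U j * sign j) sizes
  ≡⟨ ∑-cong sizes (λ j → cong (_* sign j) (countᵇ-as-∑ (hasSize j) subsets)) ⟩
    ∑ (λ j → ∑ (λ S → when (hasSize j S) (+ 1)) subsets * sign j) sizes
  ≡⟨ ∑-cong sizes (λ j → ∑-*ʳ _ (sign j) subsets) ⟩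
    ∑ (λ j → ∑ (λ S → when (hasSize j S) (+ 1) * sign j) subsets) sizes
  ≡⟨ ∑-cong sizes (λ j → ∑-cong subsets (λ S → unfold j S)) ⟩
    ∑ (λ j → ∑ (λ S → when (S ⊆ᵇ U) (when (independent G S) (when (card S ≡ᵇ j) (sign j)))) subsets) sizes
  ≡⟨ ∑-swap _ sizes subsets ⟩
    ∑ (λ S → ∑ (λ j → when (S ⊆ᵇ U) (when (independent G S) (when (card S ≡ᵇ j) (sign j)))) sizes) subsets
  ≡⟨ ∑-cong subsets collapse ⟩
    ∑ (signedIndependent G U) subsets ∎
  where
  open ≡-Reasoning
  sizes = upTo (suc n)
  subsets = allSubsets n
  hasSize : ℕ → Subset n → Bool
  hasSize j S = (S ⊆ᵇ U) ∧ independent G S ∧ (card S ≡ᵇ j)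
  unfold : ∀ j S → when (hasSize j S) (+ 1) * sign j
                 ≡ when (S ⊆ᵇ U) (when (independent G S) (when (card S ≡ᵇ j) (sign j)))
  unfold j S = trans (when-1-* (hasSize j S) (sign j))
    (trans (when-∧ (S ⊆ᵇ U) _ _) (cong (when (S ⊆ᵇ U)) (when-∧ (independent G S) _ _)))
  collapse : ∀ S → ∑ (λ j → when (S ⊆ᵇ U) (when (independent G S) (when (card S ≡ᵇ j) (sign j)))) sizes
                 ≡ signedIndependent G U S
  collapse S = trans (∑-when (S ⊆ᵇ U) _ sizes)
    (cong (when (S ⊆ᵇ U)) (trans (∑-when (independent G S) _ sizes)
      (cong (when (independent G S)) (∑-upTo-when-≡ᵇ sign (s≤s (card≤ S))))))

∑-allSubsets-suc : (f : Subset (suc n) → ℤ) →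
  ∑ f (allSubsets (suc n)) ≡ ∑ (f ∘ (false ∷_)) (allSubsets n) + ∑ (f ∘ (true ∷_)) (allSubsets n)
∑-allSubsets-suc {n} f =
  trans (∑-++ f (map (false ∷_) (allSubsets n)) _)
        (cong₂ _+_ (∑-map f (false ∷_) (allSubsets n)) (∑-map f (true ∷_) (allSubsets n)))

allᵇ-cong : {p q : A → Bool} (xs : List A) → (∀ x → p x ≡ q x) → allᵇ p xs ≡ allᵇ q xs
allᵇ-cong []       p≗q = refl
allᵇ-cong (x ∷ xs) p≗q = cong₂ _∧_ (p≗q x) (allᵇ-cong xs p≗q)

allᵇ-true : (xs : List A) → allᵇ (λ _ → true) xs ≡ true
allᵇ-true []       = refl
allᵇ-true (x ∷ xs) = allᵇ-true xs

allᵇ-∧ : (p q : A → Bool) (xs : List A) → allᵇ (λ x → p x ∧ q x) xs ≡ allᵇ p xs ∧ allᵇ q xs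
allᵇ-∧ p q []       = refl
allᵇ-∧ p q (x ∷ xs) = trans (cong (_∧_ (p x ∧ q x)) (allᵇ-∧ p q xs)) (∧-interchange (p x) (q x) _ _)

allᵇ-tabulate : (p : A → Bool) (f : Fin n → A) → allᵇ p (List.tabulate f) ≡ allᵇ (p ∘ f) (allFin n)
allᵇ-tabulate {n = 0}     p f = refl
allᵇ-tabulate {n = suc n} p f =
  cong (p (f zero) ∧_) (trans (allᵇ-tabulate p (f ∘ suc)) (sym (allᵇ-tabulate (p ∘ f) suc)))

allᵇ-allFin-suc : (p : Fin (suc n) → Bool) →
                  allᵇ p (allFin (suc n)) ≡ p zero ∧ allᵇ (p ∘ suc) (allFin n)
allᵇ-allFin-suc p = cong (p zero ∧_) (allᵇ-tabulate p suc)

⌊suc≟suc⌋ : (i j : Fin n) → ⌊ suc i ≟ suc j ⌋ ≡ ⌊ i ≟ j ⌋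
⌊suc≟suc⌋ i j with i ≟ j
... | yes _ = refl
... | no  _ = refl

allᵇ-not-∧-≟ : (f : Fin n → Bool) (v : Fin n) →
               allᵇ (λ i → not (f i ∧ ⌊ i ≟ v ⌋)) (allFin n) ≡ not (f v)
allᵇ-not-∧-≟ {suc n} f zero = begin
    allᵇ (λ i → not (f i ∧ ⌊ i ≟ zero ⌋)) (allFin (suc n))
  ≡⟨ allᵇ-allFin-suc (λ i → not (f i ∧ ⌊ i ≟ zero ⌋)) ⟩
    not (f zero ∧ true) ∧ allᵇ (λ i → not (f (suc i) ∧ false)) (allFin n)
  ≡⟨ cong₂ (λ x y → not x ∧ y) (∧-identityʳ (f zero))
       (trans (allᵇ-cong (allFin n) (λ i → cong not (∧-zeroʳ (f (suc i))))) (allᵇ-true (allFin n))) ⟩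
    not (f zero) ∧ true
  ≡⟨ ∧-identityʳ _ ⟩
    not (f zero) ∎
  where open ≡-Reasoning
allᵇ-not-∧-≟ {suc n} f (suc v) =
  trans (allᵇ-allFin-suc (λ i → not (f i ∧ ⌊ i ≟ suc v ⌋)))
        (cong₂ _∧_ (cong not (∧-zeroʳ (f zero)))
                   (trans (allᵇ-cong (allFin n) (λ i → cong (λ x → not (f (suc i) ∧ x)) (⌊suc≟suc⌋ i v)))
                          (allᵇ-not-∧-≟ (f ∘ suc) v)))

∷-⊆ᵇ-∷ : ∀ b c (S U : Subset n) → ((b ∷ S) ⊆ᵇ (c ∷ U)) ≡ (not b ∨ c) ∧ (S ⊆ᵇ U)
∷-⊆ᵇ-∷ b c S U = allᵇ-allFin-suc (λ i → not (i ∈ˢ (b ∷ S)) ∨ (i ∈ˢ (c ∷ U)))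

⊆ᵇ-fullSet : (S : Subset n) → (S ⊆ᵇ fullSet n) ≡ true
⊆ᵇ-fullSet {n} S =
  trans (allᵇ-cong (allFin n) (λ i → trans (cong (not (lookup S i) ∨_) (lookup-replicate i true)) (∨-zeroʳ _)))
        (allᵇ-true (allFin n))

⊆ᵇ-minusV : (S : Subset n) (v : Fin n) → (S ⊆ᵇ minusV v) ≡ not (lookup S v)
⊆ᵇ-minusV {n} S v =
  trans (allᵇ-cong (allFin n) (λ i → trans (cong (not (lookup S i) ∨_) (lookup∘tabulate _ i))
                                            (deMorgan (lookup S i) _)))
        (allᵇ-not-∧-≟ (lookup S) v)
  where
  deMorgan : ∀ x y → (not x ∨ not y) ≡ not (x ∧ y)
  deMorgan true  y = refl
  deMorgan false y = refl

minusV-zero : minusV {suc n} zero ≡ false ∷ fullSet n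
minusV-zero {n} = cong (false ∷_)
  (trans (tabulate-cong (λ i → sym (lookup-replicate i true))) (tabulate∘lookup (replicate n true)))

pendant : Graph n → Fin n → Graph (suc n)
pendant G v = record { adj = ext1Adj G v ; sym = ext1Sym G v ; irrefl = ext1Irr G v }

independent-pendant-false : (G : Graph n) (v : Fin n) (S : Subset n) →
  independent (pendant G v) (false ∷ S) ≡ independent G S
independent-pendant-false {n} G v S = begin
    independent (pendant G v) (false ∷ S)
  ≡⟨ allᵇ-allFin-suc row' ⟩
    allᵇ (λ _ → true) (allFin (suc n)) ∧ allᵇ (λ i → row' (suc i)) (allFin n)
  ≡⟨ cong₂ _∧_ (allᵇ-true (allFin (suc n))) (allᵇ-cong (allFin n) (λ i → allᵇ-allFin-suc (entry (suc i)))) ⟩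
    allᵇ (λ i → not (lookup S i ∧ false ∧ ⌊ i ≟ v ⌋) ∧ row i) (allFin n)
  ≡⟨ allᵇ-cong (allFin n) (λ i → cong (λ x → not x ∧ row i) (∧-zeroʳ (lookup S i))) ⟩
    independent G S ∎
  where
  open ≡-Reasoning
  entry : Fin (suc n) → Fin (suc n) → Bool
  entry i j = not (lookup (false ∷ S) i ∧ lookup (false ∷ S) j ∧ ext1Adj G v i j)
  row' : Fin (suc n) → Bool
  row' i = allᵇ (entry i) (allFin (suc n))
  row : Fin n → Bool
  row i = allᵇ (λ j → not (lookup S i ∧ lookup S j ∧ adj G i j)) (allFin n)

independent-pendant-true : (G : Graph n) (v : Fin n) (S : Subset n) →
  independent (pendant G v) (true ∷ S) ≡ not (lookup S v) ∧ independent G S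
independent-pendant-true {n} G v S = begin
    independent (pendant G v) (true ∷ S)
  ≡⟨ allᵇ-allFin-suc row' ⟩
    row' zero ∧ allᵇ (λ i → row' (suc i)) (allFin n)
  ≡⟨ cong₂ _∧_ (trans (allᵇ-allFin-suc (entry zero)) (allᵇ-not-∧-≟ (lookup S) v))
               (allᵇ-cong (allFin n) (λ i → allᵇ-allFin-suc (entry (suc i)))) ⟩
    not (lookup S v) ∧ allᵇ (λ i → not (lookup S i ∧ ⌊ i ≟ v ⌋) ∧ row i) (allFin n)
  ≡⟨ cong (not (lookup S v) ∧_) (trans (allᵇ-∧ _ row (allFin n))
                                       (cong (_∧ independent G S) (allᵇ-not-∧-≟ (lookup S) v))) ⟩
    not (lookup S v) ∧ (not (lookup S v) ∧ independent G S)
  ≡⟨ sym (∧-assoc (not (lookup S v)) _ _) ⟩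
    (not (lookup S v) ∧ not (lookup S v)) ∧ independent G S
  ≡⟨ cong (_∧ independent G S) (∧-idem _) ⟩
    not (lookup S v) ∧ independent G S ∎
  where
  open ≡-Reasoning
  entry : Fin (suc n) → Fin (suc n) → Bool
  entry i j = not (lookup (true ∷ S) i ∧ lookup (true ∷ S) j ∧ ext1Adj G v i j)
  row' : Fin (suc n) → Bool
  row' i = allᵇ (entry i) (allFin (suc n))
  row : Fin n → Bool
  row i = allᵇ (λ j → not (lookup S i ∧ lookup S j ∧ adj G i j)) (allFin n)

signedIndependent-pendant-false : (G : Graph n) (v : Fin n) (c : Bool) (U S : Subset n) →
  signedIndependent (pendant G v) (c ∷ U) (false ∷ S) ≡ signedIndependent G U S
signedIndependent-pendant-false G v c U S =
  cong₂ (λ x y → when x (when y (sign (card S)))) (∷-⊆ᵇ-∷ false c S U) (independent-pendant-false G v S)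

Iat-1-pendant-without-leaf : (G : Graph n) (v : Fin n) (U : Subset n) →
  Iat-1 (pendant G v) (false ∷ U) ≡ Iat-1 G U
Iat-1-pendant-without-leaf {n} G v U = begin
    Iat-1 (pendant G v) (false ∷ U)
  ≡⟨ trans (Iat-1-as-∑ (pendant G v) (false ∷ U)) (∑-allSubsets-suc σ′) ⟩
    ∑ (σ′ ∘ (false ∷_)) (allSubsets n)
      + ∑ (σ′ ∘ (true ∷_)) (allSubsets n)
  ≡⟨ cong₂ _+_ (∑-cong (allSubsets n) (signedIndependent-pendant-false G v false U))
               (trans (∑-cong (allSubsets n) leafExcluded) (∑-zero (allSubsets n))) ⟩
    ∑ (signedIndependent G U) (allSubsets n) + + 0
  ≡⟨ trans (+-identityʳ _) (sym (Iat-1-as-∑ G U)) ⟩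
    Iat-1 G U ∎
  where
  open ≡-Reasoning
  σ′ = signedIndependent (pendant G v) (false ∷ U)
  leafExcluded : ∀ S → σ′ (true ∷ S) ≡ + 0
  leafExcluded S = cong (λ x → when x (when (independent (pendant G v) (true ∷ S)) (sign (card (true ∷ S)))))
                        (∷-⊆ᵇ-∷ true false S U)

Iat-1-pendant : (G : Graph n) (v : Fin n) →
  Iat-1 (pendant G v) (fullSet (suc n)) ≡ Iat-1 G (fullSet n) - Iat-1 G (minusV v)
Iat-1-pendant {n} G v = begin
    Iat-1 (pendant G v) (fullSet (suc n))
  ≡⟨ trans (Iat-1-as-∑ (pendant G v) (fullSet (suc n))) (∑-allSubsets-suc σ′) ⟩
    ∑ (σ′ ∘ (false ∷_)) (allSubsets n)
      + ∑ (σ′ ∘ (true ∷_)) (allSubsets n)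
  ≡⟨ cong₂ _+_ (∑-cong (allSubsets n) (signedIndependent-pendant-false G v true (fullSet n)))
               (trans (∑-cong (allSubsets n) leafIncluded) (∑-neg _ (allSubsets n))) ⟩
    ∑ (signedIndependent G (fullSet n)) (allSubsets n) - ∑ (signedIndependent G (minusV v)) (allSubsets n)
  ≡⟨ sym (cong₂ _-_ (Iat-1-as-∑ G (fullSet n)) (Iat-1-as-∑ G (minusV v))) ⟩
    Iat-1 G (fullSet n) - Iat-1 G (minusV v) ∎
  where
  open ≡-Reasoning
  σ′ = signedIndependent (pendant G v) (fullSet (suc n))
  leafIncluded : ∀ S → σ′ (true ∷ S) ≡ - signedIndependent G (minusV v) S
  leafIncluded S = begin
      when ((true ∷ S) ⊆ᵇ fullSet (suc n)) (when (independent (pendant G v) (true ∷ S)) (- sign (card S)))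
    ≡⟨ cong₂ (λ x y → when x (when y (- sign (card S))))
             (trans (∷-⊆ᵇ-∷ true true S (fullSet n)) (⊆ᵇ-fullSet S)) (independent-pendant-true G v S) ⟩
      when (not (lookup S v) ∧ independent G S) (- sign (card S))
    ≡⟨ trans (when-neg (not (lookup S v) ∧ independent G S) (sign (card S)))
             (cong -_ (when-∧ (not (lookup S v)) (independent G S) (sign (card S)))) ⟩
      - when (not (lookup S v)) (when (independent G S) (sign (card S)))
    ≡⟨ cong (λ x → - when x (when (independent G S) (sign (card S)))) (sym (⊆ᵇ-minusV S v)) ⟩
      - signedIndependent G (minusV v) S ∎

bracket-ext1 : ∀ R {x a b y : ℤ} → bracket R ≡ (x , a , b) → x - a ≡ y → bracket (ext1 R) ≡ (y , x , a)
bracket-ext1 (rooted n G v) refl refl =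
  cong₂ _,_ (Iat-1-pendant G v)
    (cong₂ _,_ (trans (cong (Iat-1 (pendant G v)) minusV-zero) (Iat-1-pendant-without-leaf G v (fullSet n)))
               (Iat-1-pendant-without-leaf G v (minusV v)))

lemma2p3 : (R : Rooted) (a b : ℤ) → bracket R ≡ (a - b , a , b) →
    bracket (ext 1 R) ≡ (- b , a - b , a)
    × bracket (ext 2 R) ≡ (- a , - b , a - b)
    × bracket (ext 3 R) ≡ (b - a , - a , - b)
    × IR (ext 3 R) ≡ - IR R
lemma2p3 R a b R≡ = ext1≡ , ext2≡ , ext3≡ , IR-ext3
  where
  [a-b]-a≡-b : ∀ a b → (a - b) - a ≡ - b
  [a-b]-a≡-b = solve-∀
  -b-[a-b]≡-a : ∀ a b → - b - (a - b) ≡ - a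
  -b-[a-b]≡-a = solve-∀
  -a-[-b]≡b-a : ∀ a b → - a - - b ≡ b - a
  -a-[-b]≡b-a = solve-∀
  b-a≡-[a-b] : ∀ a b → b - a ≡ - (a - b)
  b-a≡-[a-b] = solve-∀
  ext1≡ : bracket (ext 1 R) ≡ (- b , a - b , a)
  ext1≡ = bracket-ext1 R R≡ ([a-b]-a≡-b a b)
  ext2≡ : bracket (ext 2 R) ≡ (- a , - b , a - b)
  ext2≡ = bracket-ext1 (ext 1 R) ext1≡ (-b-[a-b]≡-a a b)
  ext3≡ : bracket (ext 3 R) ≡ (b - a , - a , - b)
  ext3≡ = bracket-ext1 (ext 2 R) ext2≡ (-a-[-b]≡b-a a b)
  IR-ext3 : IR (ext 3 R) ≡ - IR R
  IR-ext3 = trans (cong proj₁ ext3≡) (trans (b-a≡-[a-b] a b) (cong -_ (sym (cong proj₁ R≡))))
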